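{- Let $G=(I_1,I_2,I_3,E(G))$ be a tripartite graph with $n$ vertices and $m>\frac{n^2}{4}$ edges. Then $\tau(G)\le \frac{n^2}{3(4m-n^2)}\cdot\nu(G)$.
   Context: A tripartite graph $G=(I_1,I_2,I_3,E(G))$ is a graph whose vertex set is partitioned into three independent sets $I_1,I_2,I_3$. $\tau(G)$ is the minimum size of a set of edges whose removal leaves a triangle-free graph, and $\nu(G)$ is the maximum number of pairwise edge-disjoint triangles in $G$. -}

module Defs where

open import Data.Nat using (ℕ; zero; suc; _+_; _*_; _<_; _≤_)
open import Data.Bool using (Bool; true; false; _∧_; not; if_then_else_)
open import Data.Fin using (Fin; zero; suc; toℕ)
open import Data.Product using (Σ; ∃; _×_; _,_)
open import Relation.Binary.PropositionalEquality using (_≡_; _≢_)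
open import Relation.Nullary using (¬_)
open import Relation.Nullary.Decidable using (⌊_⌋)
import Data.Nat as ℕ
import Data.Fin as F

sumFin : (n : ℕ) → (Fin n → ℕ) → ℕ
sumFin zero f = 0
sumFin (suc n) f = f zero + sumFin n (λ i → f (suc i))

record Graph (n : ℕ) : Set where
  field
    adj   : Fin n → Fin n → Bool
    sym   : ∀ i j → adj i j ≡ adj j i
    irrefl : ∀ i → adj i i ≡ false
open Graph public

-- tripartite: vertex set partitioned into three independent sets I₁, I₂, I₃
-- (given by a map part : Fin n → Fin 3; I_c = part ⁻¹ c)
Tripartite : {n : ℕ} → Graph n → Set
Tripartite {n} G = Σ (Fin n → Fin 3) λ part →
  ∀ i j → adj G i j ≡ true → part i ≢ part j

pairCount : {n : ℕ} → (Fin n → Fin n → Bool) → ℕ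
pairCount {n} R = sumFin n λ i → sumFin n λ j →
  if ⌊ toℕ i ℕ.<? toℕ j ⌋ ∧ R i j then 1 else 0

edgeCount : {n : ℕ} → Graph n → ℕ
edgeCount G = pairCount (adj G)

record EdgeSet {n : ℕ} (G : Graph n) : Set where
  field
    mem    : Fin n → Fin n → Bool
    memSym : ∀ i j → mem i j ≡ mem j i
    sub    : ∀ i j → mem i j ≡ true → adj G i j ≡ true
open EdgeSet public

size : {n : ℕ} {G : Graph n} → EdgeSet G → ℕ
size S = pairCount (mem S)

removeAdj : {n : ℕ} (G : Graph n) → EdgeSet G → Fin n → Fin n → Bool
removeAdj G S i j = adj G i j ∧ not (mem S i j)

IsTriangle : {n : ℕ} → (Fin n → Fin n → Bool) → Fin n → Fin n → Fin n → Set
IsTriangle A i j k = (A i j ≡ true) × (A j k ≡ true) × (A i k ≡ true)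

TriangleFreeAdj : {n : ℕ} → (Fin n → Fin n → Bool) → Set
TriangleFreeAdj {n} A = ∀ (i j k : Fin n) → ¬ IsTriangle A i j k

IsCover : {n : ℕ} (G : Graph n) → EdgeSet G → Set
IsCover G S = TriangleFreeAdj (removeAdj G S)

IsTau : {n : ℕ} → Graph n → ℕ → Set
IsTau G t = (Σ (EdgeSet G) λ S → IsCover G S × size S ≡ t)
          × (∀ (S : EdgeSet G) → IsCover G S → t ≤ size S)

record Triangle {n : ℕ} (G : Graph n) : Set where
  field
    v₁ v₂ v₃ : Fin n
    ord₁₂ : v₁ F.< v₂
    ord₂₃ : v₂ F.< v₃
    isTri : IsTriangle (adj G) v₁ v₂ v₃
open Triangle public

_∈T_ : {n : ℕ} {G : Graph n} → Fin n → Triangle G → Set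
x ∈T T = (x ≡ v₁ T) Data.Sum.⊎ ((x ≡ v₂ T) Data.Sum.⊎ (x ≡ v₃ T))
  where import Data.Sum

-- two triangles share an edge iff they share two distinct vertices
ShareEdge : {n : ℕ} {G : Graph n} → Triangle G → Triangle G → Set
ShareEdge {n} T U = Σ (Fin n) λ x → Σ (Fin n) λ y →
  (x ≢ y) × (x ∈T T) × (y ∈T T) × (x ∈T U) × (y ∈T U)

IsPacking : {n : ℕ} (G : Graph n) (k : ℕ) → (Fin k → Triangle G) → Set
IsPacking G k P = ∀ a b → a ≢ b → ¬ ShareEdge (P a) (P b)

IsNu : {n : ℕ} → Graph n → ℕ → Set
IsNu G v = (Σ (Fin v → Triangle G) λ P → IsPacking G v P)
         × (∀ k (P : Fin k → Triangle G) → IsPacking G k P → k ≤ v)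

module Submission where

-- Relabel the parts so that a = |I₁| and b = |I₂| are at most c = |I₃|.  Deleting all I₁–I₂ edges
-- leaves a triangle-free graph, so τ ≤ e(I₁,I₂) ≤ ab.  List the parts as x_i, y_j, z_l and attach to
-- each cell (i,j) of the a × b grid the triple (x_i, y_j, z_{i+j mod c}).  Since i + j mod c is
-- injective in each coordinate, the triples spanning triangles are pairwise edge-disjoint, so their
-- number k is at most ν.  An edge x_i y_j whose triple is not a triangle misses a pair x_i z or y_j z,
-- and each such non-edge is charged at most once, whence m ≤ k + (a + b)c.  Together with
-- 3(ab + bc + ca) ≤ n² and 4(a + b)c ≤ n² this yields 3(4m − n²)τ ≤ n²ν.

open import Defs hiding (sym)
open import Data.Bool using (Bool; true; false; _∧_; _∨_; not; if_then_else_)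
open import Data.Bool.Properties using (∨-comm)
open import Data.Empty using (⊥; ⊥-elim)
open import Data.Fin using (Fin; zero; suc; toℕ; punchIn; punchOut; _↑ˡ_; _↑ʳ_; combine; remQuot; inject≤)
  renaming (_<_ to _<ᶠ_)
open import Data.Fin.Patterns using (0F; 1F; 2F)
open import Data.Fin.Permutation using (Permutation; _⟨$⟩ʳ_; _⟨$⟩ˡ_; inverseˡ; inverseʳ; transpose)
open import Data.Fin.Properties using (_≟_)
import Data.Fin.Properties as Fin
open import Data.List using (_∷_; [])
open import Data.Nat using (ℕ; zero; suc; _+_; _*_; _∸_; _<_; _≤_; z≤n; s≤s)
open import Data.Nat.DivMod using (_mod_; _%_; %-distribˡ-+; [m+n]%n≡m%n; m<n⇒m%n≡m)
open import Data.Nat.Properties hiding (_≟_)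
open import Data.Nat.Tactic.RingSolver using (solve-∀; solve)
open import Algebra.Properties.Semiring.Sum +-*-semiring
  using (sum; sum-syntax; ∑-distrib-+; ∑-comm; *-distribˡ-sum; sum-cong-≗; sum-remove)
open import Data.Product using (Σ; _×_; _,_; proj₁; proj₂; uncurry)
open import Data.Sum using (_⊎_; inj₁; inj₂; [_,_]′)
open import Function using (_∘_; Injective)
open import Relation.Binary using (tri<; tri≈; tri>)
open import Relation.Binary.PropositionalEquality
open import Relation.Nullary using (yes; no)
open import Relation.Nullary.Decidable using (⌊_⌋)

𝟙 : Bool → ℕ
𝟙 b = if b then 1 else 0

𝟙-complement : ∀ b → 𝟙 b + 𝟙 (not b) ≡ 1
𝟙-complement true  = refl
𝟙-complement false = refl

∧-true⁻ : ∀ {p q} → p ∧ q ≡ true → p ≡ true × q ≡ true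
∧-true⁻ {true} {true} _ = refl , refl

sumFin≡∑ : ∀ n (f : Fin n → ℕ) → sumFin n f ≡ ∑[ i < n ] f i
sumFin≡∑ zero    f = refl
sumFin≡∑ (suc n) f = cong (f zero +_) (sumFin≡∑ n (f ∘ suc))

∑-mono-≤ : ∀ {n} {f g : Fin n → ℕ} → (∀ i → f i ≤ g i) → sum f ≤ sum g
∑-mono-≤ {zero}  f≤g = z≤n
∑-mono-≤ {suc n} f≤g = +-mono-≤ (f≤g zero) (∑-mono-≤ (f≤g ∘ suc))

∑-const : ∀ n c → ∑[ i < n ] c ≡ n * c
∑-const zero    c = refl
∑-const (suc n) c = cong (c +_) (∑-const n c)

∑-injective-≤ : ∀ {m n} (h : Fin m → Fin n) → Injective _≡_ _≡_ h →
                (g : Fin n → ℕ) → ∑[ i < m ] g (h i) ≤ sum g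
∑-injective-≤ {zero}          h h-inj g = z≤n
∑-injective-≤ {suc m} {zero}  h h-inj g with () ← h zero
∑-injective-≤ {suc m} {suc n} h h-inj g = begin
  g (h zero) + ∑[ i < m ] g (h (suc i))
    ≡⟨ cong (g (h zero) +_) (sum-cong-≗ (λ i → cong g (sym (Fin.punchIn-punchOut (h₀≢ i))))) ⟩
  g (h zero) + ∑[ i < m ] g (punchIn (h zero) (h′ i))
    ≤⟨ +-monoʳ-≤ (g (h zero)) (∑-injective-≤ h′ h′-inj (g ∘ punchIn (h zero))) ⟩
  g (h zero) + ∑[ j < n ] g (punchIn (h zero) j)
    ≡⟨ sym (sum-remove g) ⟩
  sum g ∎
  where
  open ≤-Reasoning
  h₀≢ : ∀ i → h zero ≢ h (suc i)
  h₀≢ i eq = Fin.0≢1+n (h-inj eq)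
  h′ : Fin m → Fin n
  h′ i = punchOut (h₀≢ i)
  h′-inj : Injective _≡_ _≡_ h′
  h′-inj {i} {j} eq = Fin.suc-injective (h-inj (Fin.punchOut-injective (h₀≢ i) (h₀≢ j) eq))

∑-↑ : ∀ m n (f : Fin (m + n) → ℕ) →
      ∑[ p < m + n ] f p ≡ ∑[ i < m ] f (i ↑ˡ n) + ∑[ j < n ] f (m ↑ʳ j)
∑-↑ zero    n f = refl
∑-↑ (suc m) n f = trans (cong (f zero +_) (∑-↑ m n (f ∘ suc))) (sym (+-assoc (f zero) _ _))

∑-combine : ∀ m n (f : Fin (m * n) → ℕ) →
            ∑[ i < m ] ∑[ j < n ] f (combine i j) ≡ ∑[ p < m * n ] f p
∑-combine zero    n f = refl
∑-combine (suc m) n f = trans (cong (∑[ j < n ] f (j ↑ˡ m * n) +_) (∑-combine m n (f ∘ (n ↑ʳ_))))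
                              (sym (∑-↑ n (m * n) f))

∑∑-distrib-+ : ∀ {m n} (f g : Fin m → Fin n → ℕ) →
  ∑[ i < m ] ∑[ j < n ] (f i j + g i j) ≡ ∑[ i < m ] ∑[ j < n ] f i j + ∑[ i < m ] ∑[ j < n ] g i j
∑∑-distrib-+ {n = n} f g = trans (sum-cong-≗ (λ i → ∑-distrib-+ (f i) (g i)))
                                 (∑-distrib-+ (λ i → ∑[ j < n ] f i j) (λ i → ∑[ j < n ] g i j))

count : ∀ {n} → (Fin n → Bool) → ℕ
count {n} P = ∑[ x < n ] 𝟙 (P x)

select : ∀ {n} (P : Fin n → Bool) → Fin (count P) → Fin n
select {suc n} P i with P zero
select {suc n} P zero    | true  = zero
select {suc n} P (suc i) | true  = suc (select (P ∘ suc) i)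
select {suc n} P i       | false = suc (select (P ∘ suc) i)

select-holds : ∀ {n} (P : Fin n → Bool) i → P (select P i) ≡ true
select-holds {suc n} P i with P zero in P₀
select-holds {suc n} P zero    | true  = P₀
select-holds {suc n} P (suc i) | true  = select-holds (P ∘ suc) i
select-holds {suc n} P i       | false = select-holds (P ∘ suc) i

select-injective : ∀ {n} (P : Fin n → Bool) → Injective _≡_ _≡_ (select P)
select-injective {suc n} P {i} {j} eq with P zero
select-injective {suc n} P {zero}  {zero}  eq | true  = refl
select-injective {suc n} P {suc i} {suc j} eq | true  =
  cong suc (select-injective (P ∘ suc) (Fin.suc-injective eq))
select-injective {suc n} P {i}     {j}     eq | false =
  select-injective (P ∘ suc) (Fin.suc-injective eq)

∑-select : ∀ {n} (P : Fin n → Bool) (f : Fin n → ℕ) →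
           ∑[ i < count P ] f (select P i) ≡ ∑[ x < n ] (𝟙 (P x) * f x)
∑-select {zero}  P f = refl
∑-select {suc n} P f with P zero
... | true  = cong₂ _+_ (sym (+-identityʳ (f zero))) (∑-select (P ∘ suc) (f ∘ suc))
... | false = ∑-select (P ∘ suc) (f ∘ suc)

_⊕_ : ∀ {c} → Fin c → Fin c → Fin c
_⊕_ {suc c} i j = (toℕ i + toℕ j) mod suc c

⊕-comm : ∀ {c} (i j : Fin c) → i ⊕ j ≡ j ⊕ i
⊕-comm {suc c} i j rewrite +-comm (toℕ i) (toℕ j) = refl

⊕-cancelˡ : ∀ {c} (i : Fin c) {j k : Fin c} → i ⊕ j ≡ i ⊕ k → j ≡ k
⊕-cancelˡ {suc c} i {j} {k} eq =
  Fin.toℕ-injective (trans (recover j) (trans (cong (λ r → (c′ + toℕ r) % suc c) eq) (sym (recover k))))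
  where
  c′ : ℕ
  c′ = (suc c ∸ toℕ i) % suc c
  recover : ∀ j → toℕ j ≡ (c′ + toℕ (i ⊕ j)) % suc c
  recover j = begin
    toℕ j                                         ≡⟨ m<n⇒m%n≡m (Fin.toℕ<n j) ⟨
    toℕ j % suc c                                 ≡⟨ [m+n]%n≡m%n (toℕ j) (suc c) ⟨
    (toℕ j + suc c) % suc c                       ≡⟨ cong (_% suc c) shift ⟩
    (suc c ∸ toℕ i + (toℕ i + toℕ j)) % suc c     ≡⟨ %-distribˡ-+ (suc c ∸ toℕ i) _ (suc c) ⟩
    (c′ + (toℕ i + toℕ j) % suc c) % suc c        ≡⟨ cong (λ r → (c′ + r) % suc c) (Fin.toℕ-fromℕ< _) ⟨
    (c′ + toℕ (i ⊕ j)) % suc c                    ∎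
    where
    open ≡-Reasoning
    shift : toℕ j + suc c ≡ suc c ∸ toℕ i + (toℕ i + toℕ j)
    shift = begin
      toℕ j + suc c                          ≡⟨ cong (toℕ j +_) (m∸n+n≡m (Fin.toℕ≤n i)) ⟨
      toℕ j + (suc c ∸ toℕ i + toℕ i)        ≡⟨ +-comm (toℕ j) _ ⟩
      suc c ∸ toℕ i + toℕ i + toℕ j          ≡⟨ +-assoc (suc c ∸ toℕ i) (toℕ i) (toℕ j) ⟩
      suc c ∸ toℕ i + (toℕ i + toℕ j)        ∎

Among : ∀ {n} → Fin n → Fin n → Fin n → Fin n → Set
Among x y z w = w ≡ x ⊎ w ≡ y ⊎ w ≡ z

module _ {n} (G : Graph n) where

  adj-flip : ∀ {u v} → adj G u v ≡ true → adj G v u ≡ true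
  adj-flip {u} {v} e = trans (Graph.sym G v u) e

  adj⇒≢ : ∀ {u v} → adj G u v ≡ true → u ≢ v
  adj⇒≢ {u} e refl with () ← trans (sym e) (irrefl G u)

  private
    sorted : ∀ {x y z v₁ v₂ v₃} → v₁ <ᶠ v₂ → v₂ <ᶠ v₃ → IsTriangle (adj G) v₁ v₂ v₃ →
             Among x y z v₁ → Among x y z v₂ → Among x y z v₃ →
             Σ (Triangle G) λ T → ∀ {w} → w ∈T T → Among x y z w
    sorted {v₁ = v₁} {v₂} {v₃} o₁₂ o₂₃ t m₁ m₂ m₃ =
      record { v₁ = v₁ ; v₂ = v₂ ; v₃ = v₃ ; ord₁₂ = o₁₂ ; ord₂₃ = o₂₃ ; isTri = t } ,
      λ { (inj₁ refl) → m₁ ; (inj₂ (inj₁ refl)) → m₂ ; (inj₂ (inj₂ refl)) → m₃ }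

  triangle : ∀ {x y z} → IsTriangle (adj G) x y z →
             Σ (Triangle G) λ T → ∀ {w} → w ∈T T → Among x y z w
  triangle {x} {y} {z} (xy , yz , xz) with Fin.<-cmp x y | Fin.<-cmp y z | Fin.<-cmp x z
  ... | tri≈ _ x≡y _ | _ | _ = ⊥-elim (adj⇒≢ xy x≡y)
  ... | _ | tri≈ _ y≡z _ | _ = ⊥-elim (adj⇒≢ yz y≡z)
  ... | _ | _ | tri≈ _ x≡z _ = ⊥-elim (adj⇒≢ xz x≡z)
  ... | tri< x<y _ _ | tri< y<z _ _ | _ =
    sorted x<y y<z (xy , yz , xz) (inj₁ refl) (inj₂ (inj₁ refl)) (inj₂ (inj₂ refl))
  ... | tri< x<y _ _ | tri> _ _ z<y | tri< x<z _ _ =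
    sorted x<z z<y (xz , adj-flip yz , xy) (inj₁ refl) (inj₂ (inj₂ refl)) (inj₂ (inj₁ refl))
  ... | tri< x<y _ _ | tri> _ _ z<y | tri> _ _ z<x =
    sorted z<x x<y (adj-flip xz , xy , adj-flip yz) (inj₂ (inj₂ refl)) (inj₁ refl) (inj₂ (inj₁ refl))
  ... | tri> _ _ y<x | tri< y<z _ _ | tri< x<z _ _ =
    sorted y<x x<z (adj-flip xy , xz , yz) (inj₂ (inj₁ refl)) (inj₁ refl) (inj₂ (inj₂ refl))
  ... | tri> _ _ y<x | tri< y<z _ _ | tri> _ _ z<x =
    sorted y<z z<x (yz , adj-flip xz , adj-flip xy) (inj₂ (inj₁ refl)) (inj₂ (inj₂ refl)) (inj₁ refl)
  ... | tri> _ _ y<x | tri> _ _ z<y | _ =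
    sorted z<y y<x (adj-flip yz , adj-flip xy , adj-flip xz) (inj₂ (inj₂ refl)) (inj₂ (inj₁ refl)) (inj₁ refl)

pairCount≡∑∑ : ∀ {n} (R : Fin n → Fin n → Bool) →
  pairCount R ≡ ∑[ i < n ] ∑[ j < n ] 𝟙 (⌊ toℕ i <? toℕ j ⌋ ∧ R i j)
pairCount≡∑∑ {n} R = trans (sumFin≡∑ n _) (sum-cong-≗ {n} (λ i → sumFin≡∑ n _))

pairCount-≤ : ∀ {n} (R : Fin n → Fin n → Bool) (h : Fin n → Fin n → ℕ) →
  (∀ i j → R i j ≡ true → 1 ≤ h i j + h j i) → pairCount R ≤ ∑[ i < n ] ∑[ j < n ] h i j
pairCount-≤ {n} R h covered = begin
  pairCount R                                         ≡⟨ pairCount≡∑∑ R ⟩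
  ∑[ i < n ] ∑[ j < n ] 𝟙 (⌊ toℕ i <? toℕ j ⌋ ∧ R i j) ≤⟨ ∑-mono-≤ (λ i → ∑-mono-≤ (oriented i)) ⟩
  ∑[ i < n ] ∑[ j < n ] (lt i j * h i j + lt i j * h j i)
    ≡⟨ ∑∑-distrib-+ (λ i j → lt i j * h i j) (λ i j → lt i j * h j i) ⟩
  ∑[ i < n ] ∑[ j < n ] (lt i j * h i j) + ∑[ i < n ] ∑[ j < n ] (lt i j * h j i)
    ≡⟨ cong (∑[ i < n ] ∑[ j < n ] (lt i j * h i j) +_) (∑-comm (λ i j → lt i j * h j i)) ⟩
  ∑[ i < n ] ∑[ j < n ] (lt i j * h i j) + ∑[ i < n ] ∑[ j < n ] (lt j i * h i j)
    ≡⟨ ∑∑-distrib-+ (λ i j → lt i j * h i j) (λ i j → lt j i * h i j) ⟨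
  ∑[ i < n ] ∑[ j < n ] (lt i j * h i j + lt j i * h i j) ≤⟨ ∑-mono-≤ (λ i → ∑-mono-≤ (once i)) ⟩
  ∑[ i < n ] ∑[ j < n ] h i j                          ∎
  where
  open ≤-Reasoning
  lt : Fin n → Fin n → ℕ
  lt i j = 𝟙 ⌊ toℕ i <? toℕ j ⌋
  oriented : ∀ i j → 𝟙 (⌊ toℕ i <? toℕ j ⌋ ∧ R i j) ≤ lt i j * h i j + lt i j * h j i
  oriented i j with toℕ i <? toℕ j | R i j in Rij
  ... | no _  | _     = z≤n
  ... | yes _ | false = z≤n
  ... | yes _ | true  =
    ≤-trans (covered i j Rij) (≤-reflexive (sym (cong₂ _+_ (*-identityˡ (h i j)) (*-identityˡ (h j i)))))
  once : ∀ i j → lt i j * h i j + lt j i * h i j ≤ h i j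
  once i j with toℕ i <? toℕ j | toℕ j <? toℕ i
  ... | yes i<j | yes j<i = ⊥-elim (<-asym i<j j<i)
  ... | yes _   | no _    = ≤-reflexive (trans (+-identityʳ _) (*-identityˡ _))
  ... | no _    | yes _   = ≤-reflexive (*-identityˡ _)
  ... | no _    | no _    = z≤n

rearrangement : ∀ {p q r s} → p ≤ q → r ≤ s → p * s + q * r ≤ p * r + q * s
rearrangement {p} {q} {r} {s} p≤q r≤s with q ∸ p | m+[n∸m]≡n p≤q | s ∸ r | m+[n∸m]≡n r≤s
... | u | refl | v | refl = begin
  p * (r + v) + (p + u) * r           ≤⟨ m≤m+n _ (u * v) ⟩
  p * (r + v) + (p + u) * r + u * v   ≡⟨ solve (p ∷ r ∷ u ∷ v ∷ []) ⟩
  p * r + (p + u) * (r + v)           ∎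
  where open ≤-Reasoning

2mn≤m²+n² : ∀ m n → 2 * (m * n) ≤ m * m + n * n
2mn≤m²+n² m n = begin
  2 * (m * n)        ≡⟨ solve (m ∷ n ∷ []) ⟩
  m * n + n * m
    ≤⟨ [ (λ m≤n → rearrangement m≤n m≤n) , (λ n≤m → swap (rearrangement n≤m n≤m)) ]′ (≤-total m n) ⟩
  m * m + n * n      ∎
  where
  open ≤-Reasoning
  swap : n * m + m * n ≤ n * n + m * m → m * n + n * m ≤ m * m + n * n
  swap = subst₂ _≤_ (+-comm (n * m) (m * n)) (+-comm (n * n) (m * m))

4mn≤[m+n]² : ∀ m n → 4 * (m * n) ≤ (m + n) * (m + n)
4mn≤[m+n]² m n = begin
  4 * (m * n)                     ≡⟨ solve (m ∷ n ∷ []) ⟩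
  2 * (m * n) + 2 * (m * n)       ≤⟨ +-monoˡ-≤ (2 * (m * n)) (2mn≤m²+n² m n) ⟩
  m * m + n * n + 2 * (m * n)     ≡⟨ solve (m ∷ n ∷ []) ⟩
  (m + n) * (m + n)               ∎
  where open ≤-Reasoning

3[ab+bc+ca]≤[a+b+c]² : ∀ a b c → 3 * (a * b + (a + b) * c) ≤ (a + b + c) * (a + b + c)
3[ab+bc+ca]≤[a+b+c]² a b c = begin
  3 * (a * b + (a + b) * c)                                  ≡⟨ solve (a ∷ b ∷ c ∷ []) ⟩
  (a * b + b * c + a * c) + 2 * (a * b + b * c + a * c)      ≤⟨ +-monoˡ-≤ _ products≤squares ⟩
  (a * a + b * b + c * c) + 2 * (a * b + b * c + a * c)      ≡⟨ solve (a ∷ b ∷ c ∷ []) ⟩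
  (a + b + c) * (a + b + c)                                  ∎
  where
  open ≤-Reasoning
  products≤squares : a * b + b * c + a * c ≤ a * a + b * b + c * c
  products≤squares = *-cancelˡ-≤ 2 (begin
    2 * (a * b + b * c + a * c)                              ≡⟨ solve (a ∷ b ∷ c ∷ []) ⟩
    2 * (a * b) + 2 * (b * c) + 2 * (a * c)
      ≤⟨ +-mono-≤ (+-mono-≤ (2mn≤m²+n² a b) (2mn≤m²+n² b c)) (2mn≤m²+n² a c) ⟩
    (a * a + b * b) + (b * b + c * c) + (a * a + c * c)      ≡⟨ solve (a ∷ b ∷ c ∷ []) ⟩
    2 * (a * a + b * b + c * c)                              ∎)

-- Here d = 4m − n², N = n² and x = (a + b)c.  When 12e > N the rearrangement slack
-- (12e − N)(e − k) ≥ 0 is exactly what is needed.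
3de≤Nk : ∀ {N x k e d} → d + N ≤ 4 * (k + x) → k ≤ e → 4 * x ≤ N → 3 * (e + x) ≤ N →
         3 * d * e ≤ N * k
3de≤Nk {N} {x} {k} {e} {d} d+N≤ k≤e 4x≤N 3[e+x]≤N with 12 * e ≤? N
... | yes 12e≤N = begin
  3 * d * e        ≤⟨ *-monoˡ-≤ e (*-monoʳ-≤ 3 d≤4k) ⟩
  3 * (4 * k) * e  ≡⟨ solve (k ∷ e ∷ []) ⟩
  k * (12 * e)     ≤⟨ *-monoʳ-≤ k 12e≤N ⟩
  k * N            ≡⟨ *-comm k N ⟩
  N * k            ∎
  where
  open ≤-Reasoning
  d≤4k : d ≤ 4 * k
  d≤4k = +-cancelʳ-≤ N d (4 * k) (begin
    d + N            ≤⟨ d+N≤ ⟩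
    4 * (k + x)      ≡⟨ *-distribˡ-+ 4 k x ⟩
    4 * k + 4 * x    ≤⟨ +-monoʳ-≤ (4 * k) 4x≤N ⟩
    4 * k + N        ∎)
... | no 12e≰N = +-cancelʳ-≤ (3 * e * N + N * e) _ _ (begin
  3 * d * e + (3 * e * N + N * e)           ≡⟨ solve (N ∷ e ∷ d ∷ []) ⟩
  3 * e * (d + N) + N * e                   ≤⟨ +-monoˡ-≤ (N * e) (*-monoʳ-≤ (3 * e) d+N≤) ⟩
  3 * e * (4 * (k + x)) + N * e             ≡⟨ solve (N ∷ x ∷ k ∷ e ∷ []) ⟩
  N * e + 12 * e * k + 12 * e * x           ≤⟨ +-monoˡ-≤ (12 * e * x) (rearrangement (<⇒≤ (≰⇒> 12e≰N)) k≤e) ⟩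
  N * k + 12 * e * e + 12 * e * x           ≡⟨ solve (N ∷ x ∷ k ∷ e ∷ []) ⟩
  N * k + 4 * e * (3 * (e + x))             ≤⟨ +-monoʳ-≤ (N * k) (*-monoʳ-≤ (4 * e) 3[e+x]≤N) ⟩
  N * k + 4 * e * N                         ≡⟨ solve (N ∷ k ∷ e ∷ []) ⟩
  N * k + (3 * e * N + N * e)               ∎)
  where open ≤-Reasoning

cover-vs-packing : ∀ {a b c n m k e} → a + b + c ≡ n → m ≤ k + (a + b) * c → k ≤ e → e ≤ a * b →
                   n * n ≤ 4 * m → 3 * (4 * m ∸ n * n) * e ≤ n * n * k
cover-vs-packing {a} {b} {c} {m = m} {k} {e} refl m≤ k≤e e≤ab n²≤4m =
  3de≤Nk d+N≤ k≤e (4mn≤[m+n]² (a + b) c) 3[e+x]≤N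
  where
  N : ℕ
  N = (a + b + c) * (a + b + c)
  d+N≤ : 4 * m ∸ N + N ≤ 4 * (k + (a + b) * c)
  d+N≤ = ≤-trans (≤-reflexive (m∸n+n≡m n²≤4m)) (*-monoʳ-≤ 4 m≤)
  3[e+x]≤N : 3 * (e + (a + b) * c) ≤ N
  3[e+x]≤N = ≤-trans (*-monoʳ-≤ 3 (+-monoˡ-≤ ((a + b) * c) e≤ab)) (3[ab+bc+ca]≤[a+b+c]² a b c)

between : ∀ {n} → (Fin n → Fin n → Bool) → (Fin n → Bool) → (Fin n → Bool) → ℕ
between {n} R X Y = ∑[ u < n ] ∑[ v < n ] (𝟙 (X u) * (𝟙 (Y v) * 𝟙 (R u v)))

between-select : ∀ {n} (R : Fin n → Fin n → Bool) (X Y : Fin n → Bool) →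
  between R X Y ≡ ∑[ i < count X ] ∑[ j < count Y ] 𝟙 (R (select X i) (select Y j))
between-select {n} R X Y = begin
  between R X Y
    ≡⟨ sum-cong-≗ {n} (λ u → *-distribˡ-sum (𝟙 (X u)) (λ v → 𝟙 (Y v) * 𝟙 (R u v))) ⟨
  ∑[ u < n ] (𝟙 (X u) * ∑[ v < n ] (𝟙 (Y v) * 𝟙 (R u v)))
    ≡⟨ ∑-select X (λ u → ∑[ v < n ] (𝟙 (Y v) * 𝟙 (R u v))) ⟨
  ∑[ i < count X ] ∑[ v < n ] (𝟙 (Y v) * 𝟙 (R (select X i) v))
    ≡⟨ sum-cong-≗ (λ i → ∑-select Y (λ v → 𝟙 (R (select X i) v))) ⟨
  ∑[ i < count X ] ∑[ j < count Y ] 𝟙 (R (select X i) (select Y j)) ∎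
  where open ≡-Reasoning

between-complement : ∀ {n} (R : Fin n → Fin n → Bool) (X Y : Fin n → Bool) →
  between R X Y + between (λ u v → not (R u v)) X Y ≡ count X * count Y
between-complement R X Y = begin
  between R X Y + between (λ u v → not (R u v)) X Y
    ≡⟨ cong₂ _+_ (between-select R X Y) (between-select (λ u v → not (R u v)) X Y) ⟩
  ∑[ i < count X ] ∑[ j < count Y ] r i j + ∑[ i < count X ] ∑[ j < count Y ] r̄ i j
    ≡⟨ ∑∑-distrib-+ r r̄ ⟨
  ∑[ i < count X ] ∑[ j < count Y ] (r i j + r̄ i j)
    ≡⟨ sum-cong-≗ {count X} (λ i → sum-cong-≗ {count Y} (λ j → 𝟙-complement (R (select X i) (select Y j)))) ⟩
  ∑[ i < count X ] ∑[ j < count Y ] 1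
    ≡⟨ sum-cong-≗ {count X} (λ i → trans (∑-const (count Y) 1) (*-identityʳ (count Y))) ⟩
  ∑[ i < count X ] count Y
    ≡⟨ ∑-const (count X) (count Y) ⟩
  count X * count Y ∎
  where
  open ≡-Reasoning
  r r̄ : Fin (count X) → Fin (count Y) → ℕ
  r i j = 𝟙 (R (select X i) (select Y j))
  r̄ i j = 𝟙 (not (R (select X i) (select Y j)))

coord : ∀ {X : Set} → Fin 3 → X → X → X → X
coord 0F x y z = x
coord 1F x y z = y
coord 2F x y z = z

inPart : ∀ {n} → (Fin n → Fin 3) → Fin 3 → Fin n → Bool
inPart part K u = ⌊ part u ≟ K ⌋

inPart⇒≡ : ∀ {n} (part : Fin n → Fin 3) {K u} → inPart part K u ≡ true → part u ≡ K
inPart⇒≡ part {K} {u} e with part u ≟ K | e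
... | yes eq | _ = eq

module Tripartition {n} (G : Graph n) (part : Fin n → Fin 3)
                    (proper : ∀ u v → adj G u v ≡ true → part u ≢ part v) where

  nonAdj : Fin n → Fin n → Bool
  nonAdj u v = not (adj G u v)

  A B C : Fin n → Bool
  A = inPart part 0F
  B = inPart part 1F
  C = inPart part 2F

  a b c : ℕ
  a = count A
  b = count B
  c = count C

  a+b+c≡n : a + b + c ≡ n
  a+b+c≡n = begin
    a + b + c                                  ≡⟨ cong (_+ c) (∑-distrib-+ (𝟙 ∘ A) (𝟙 ∘ B)) ⟨
    ∑[ u < n ] (𝟙 (A u) + 𝟙 (B u)) + c         ≡⟨ ∑-distrib-+ (λ u → 𝟙 (A u) + 𝟙 (B u)) (𝟙 ∘ C) ⟨
    ∑[ u < n ] (𝟙 (A u) + 𝟙 (B u) + 𝟙 (C u))  ≡⟨ sum-cong-≗ {n} one-part ⟩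
    ∑[ u < n ] 1                               ≡⟨ trans (∑-const n 1) (*-identityʳ n) ⟩
    n                                          ∎
    where
    open ≡-Reasoning
    one-part : ∀ u → 𝟙 (A u) + 𝟙 (B u) + 𝟙 (C u) ≡ 1
    one-part u with part u
    ... | 0F = refl
    ... | 1F = refl
    ... | 2F = refl

  edgeCount-≤ : edgeCount G ≤ between (adj G) A B + between (adj G) A C + between (adj G) B C
  edgeCount-≤ = begin
    edgeCount G                         ≤⟨ pairCount-≤ (adj G) (λ u v → t A B u v + t A C u v + t B C u v) crossing ⟩
    ∑[ u < n ] ∑[ v < n ] (t A B u v + t A C u v + t B C u v)
      ≡⟨ ∑∑-distrib-+ (λ u v → t A B u v + t A C u v) (t B C) ⟩
    ∑[ u < n ] ∑[ v < n ] (t A B u v + t A C u v) + between (adj G) B C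
      ≡⟨ cong (_+ between (adj G) B C) (∑∑-distrib-+ (t A B) (t A C)) ⟩
    between (adj G) A B + between (adj G) A C + between (adj G) B C ∎
    where
    open ≤-Reasoning
    t : (Fin n → Bool) → (Fin n → Bool) → Fin n → Fin n → ℕ
    t X Y u v = 𝟙 (X u) * (𝟙 (Y v) * 𝟙 (adj G u v))
    crossing : ∀ u v → adj G u v ≡ true → 1 ≤ t A B u v + t A C u v + t B C u v + (t A B v u + t A C v u + t B C v u)
    crossing u v uv rewrite uv | adj-flip G uv with part u in pu | part v in pv
    ... | 0F | 1F = s≤s z≤n
    ... | 0F | 2F = s≤s z≤n
    ... | 1F | 0F = s≤s z≤n
    ... | 1F | 2F = s≤s z≤n
    ... | 2F | 0F = s≤s z≤n
    ... | 2F | 1F = s≤s z≤n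
    ... | 0F | 0F = ⊥-elim (proper u v uv (trans pu (sym pv)))
    ... | 1F | 1F = ⊥-elim (proper u v uv (trans pu (sym pv)))
    ... | 2F | 2F = ⊥-elim (proper u v uv (trans pu (sym pv)))

  avoidingC : EdgeSet G
  avoidingC = record
    { mem    = λ u v → adj G u v ∧ not (C u ∨ C v)
    ; memSym = λ u v → cong₂ _∧_ (Graph.sym G u v) (cong not (∨-comm (C u) (C v)))
    ; sub    = λ u v e → proj₁ (∧-true⁻ e)
    }

  survivor : ∀ {u v} → removeAdj G avoidingC u v ≡ true → adj G u v ≡ true × (C u ∨ C v) ≡ true
  survivor {u} {v} e with adj G u v | C u ∨ C v | e
  ... | true  | true  | _  = refl , refl
  ... | true  | false | ()
  ... | false | _     | ()

  C-independent : ∀ {u v} → adj G u v ≡ true → C u ≡ true → C v ≡ true → ⊥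
  C-independent {u} {v} uv cu cv = proper u v uv (trans (inPart⇒≡ part cu) (sym (inPart⇒≡ part cv)))

  avoidingC-cover : IsCover G avoidingC
  avoidingC-cover u v w (uv , vw , uw)
    with survivor uv | survivor vw | survivor uw
  ... | uv′ , Cu∨Cv | vw′ , Cv∨Cw | uw′ , Cu∨Cw with C u in cu | C v in cv | C w in cw
  ... | true  | true  | _     = C-independent uv′ cu cv
  ... | true  | false | true  = C-independent uw′ cu cw
  ... | _     | true  | true  = C-independent vw′ cv cw
  ... | true  | false | false with () ← Cv∨Cw
  ... | false | true  | false with () ← Cu∨Cw
  ... | false | false | _     with () ← Cu∨Cv

  size-avoidingC : size avoidingC ≤ between (adj G) A B
  size-avoidingC = pairCount-≤ (mem avoidingC) (λ u v → 𝟙 (A u) * (𝟙 (B v) * 𝟙 (adj G u v))) crossesAB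
    where
    crossesAB : ∀ u v → mem avoidingC u v ≡ true →
                1 ≤ 𝟙 (A u) * (𝟙 (B v) * 𝟙 (adj G u v)) + 𝟙 (A v) * (𝟙 (B u) * 𝟙 (adj G v u))
    crossesAB u v e with ∧-true⁻ {adj G u v} e
    ... | uv , ¬C rewrite uv | adj-flip G uv with part u in pu | part v in pv | ¬C
    ... | 0F | 1F | _ = s≤s z≤n
    ... | 1F | 0F | _ = s≤s z≤n
    ... | 0F | 0F | _ = ⊥-elim (proper u v uv (trans pu (sym pv)))
    ... | 1F | 1F | _ = ⊥-elim (proper u v uv (trans pu (sym pv)))
    ... | 2F | _  | ()
    ... | 0F | 2F | ()
    ... | 1F | 2F | ()

  τ≤AB : ∀ {t} → IsTau G t → t ≤ between (adj G) A B
  τ≤AB (_ , minimal) = ≤-trans (minimal avoidingC avoidingC-cover) size-avoidingC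

  AB≤ab : between (adj G) A B ≤ a * b
  AB≤ab = ≤-trans (m≤m+n _ (between nonAdj A B)) (≤-reflexive (between-complement (adj G) A B))

  Transversal : Fin n → Fin n → Fin n → Set
  Transversal x y z = part x ≡ 0F × part y ≡ 1F × part z ≡ 2F

  coord-part : ∀ {x y z u} → Transversal x y z → Among x y z u → coord (part u) x y z ≡ u
  coord-part (px , _  , _ ) (inj₁ refl)        rewrite px = refl
  coord-part (_  , py , _ ) (inj₂ (inj₁ refl)) rewrite py = refl
  coord-part (_  , _  , pz) (inj₂ (inj₂ refl)) rewrite pz = refl

  two-coordinates-agree : ∀ {x y z x′ y′ z′ u w} → Transversal x y z → Transversal x′ y′ z′ → u ≢ w →
    Among x y z u → Among x y z w → Among x′ y′ z′ u → Among x′ y′ z′ w →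
    Σ (Fin 3) λ K → Σ (Fin 3) λ L → K ≢ L × coord K x y z ≡ coord K x′ y′ z′ × coord L x y z ≡ coord L x′ y′ z′
  two-coordinates-agree {x} {y} {z} {u = u} {w} t t′ u≢w u∈ w∈ u∈′ w∈′ =
    _ , _ , distinct , trans (coord-part t u∈) (sym (coord-part t′ u∈′))
                     , trans (coord-part t w∈) (sym (coord-part t′ w∈′))
    where
    distinct : part u ≢ part w
    distinct pu≡pw = u≢w (trans (sym (coord-part t u∈))
                                (trans (cong (λ K → coord K x y z) pu≡pw) (coord-part t w∈)))

  module LatinPacking (a≤c : a ≤ c) (b≤c : b ≤ c) where

    x : Fin a → Fin n
    x = select A
    y : Fin b → Fin n
    y = select B
    z : Fin c → Fin n
    z = select C

    cell : Fin a → Fin b → Fin c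
    cell i j = inject≤ i a≤c ⊕ inject≤ j b≤c

    cell-injectiveʳ : ∀ i → Injective _≡_ _≡_ (cell i)
    cell-injectiveʳ i eq = Fin.inject≤-injective b≤c b≤c _ _ (⊕-cancelˡ (inject≤ i a≤c) eq)

    cell-injectiveˡ : ∀ j → Injective _≡_ _≡_ (λ i → cell i j)
    cell-injectiveˡ j {i} {i′} eq = Fin.inject≤-injective a≤c a≤c i i′
      (⊕-cancelˡ (inject≤ j b≤c) (trans (⊕-comm _ _) (trans eq (⊕-comm _ _))))

    apex : Fin a → Fin b → Fin n
    apex i j = z (cell i j)

    transversal : ∀ i j → Transversal (x i) (y j) (apex i j)
    transversal i j = inPart⇒≡ part (select-holds A i) , inPart⇒≡ part (select-holds B j)
                    , inPart⇒≡ part (select-holds C (cell i j))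

    same-cell : ∀ {i j i′ j′} K L → K ≢ L →
      coord K (x i) (y j) (apex i j) ≡ coord K (x i′) (y j′) (apex i′ j′) →
      coord L (x i) (y j) (apex i j) ≡ coord L (x i′) (y j′) (apex i′ j′) → (i , j) ≡ (i′ , j′)
    same-cell 0F 1F _ xx yy with refl ← select-injective A xx | refl ← select-injective B yy = refl
    same-cell 1F 0F _ yy xx with refl ← select-injective A xx | refl ← select-injective B yy = refl
    same-cell {i} 0F 2F _ xx zz with refl ← select-injective A xx =
      cong (i ,_) (cell-injectiveʳ i (select-injective C zz))
    same-cell {i} 2F 0F _ zz xx with refl ← select-injective A xx =
      cong (i ,_) (cell-injectiveʳ i (select-injective C zz))
    same-cell {j = j} 1F 2F _ yy zz with refl ← select-injective B yy =
      cong (_, j) (cell-injectiveˡ j (select-injective C zz))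
    same-cell {j = j} 2F 1F _ zz yy with refl ← select-injective B yy =
      cong (_, j) (cell-injectiveˡ j (select-injective C zz))
    same-cell 0F 0F K≢K = ⊥-elim (K≢K refl)
    same-cell 1F 1F K≢K = ⊥-elim (K≢K refl)
    same-cell 2F 2F K≢K = ⊥-elim (K≢K refl)

    complete : Fin a → Fin b → Bool
    complete i j = adj G (x i) (y j) ∧ (adj G (x i) (apex i j) ∧ adj G (y j) (apex i j))

    -- Cells are flattened to Fin (a * b) so that select can enumerate the complete ones.
    complete♭ : Fin (a * b) → Bool
    complete♭ p = uncurry complete (remQuot b p)

    k : ℕ
    k = count complete♭

    cellOf : Fin k → Fin a × Fin b
    cellOf s = remQuot b (select complete♭ s)

    cellOf-injective : Injective _≡_ _≡_ cellOf
    cellOf-injective {s} {t} eq = select-injective complete♭ (begin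
      select complete♭ s             ≡⟨ Fin.combine-remQuot {a} b _ ⟨
      uncurry combine (cellOf s)     ≡⟨ cong (uncurry combine) eq ⟩
      uncurry combine (cellOf t)     ≡⟨ Fin.combine-remQuot {a} b _ ⟩
      select complete♭ t             ∎)
      where open ≡-Reasoning

    cellTriangle : ∀ {i j} → complete i j ≡ true →
                   Σ (Triangle G) λ T → ∀ {w} → w ∈T T → Among (x i) (y j) (apex i j) w
    cellTriangle c with ∧-true⁻ c
    ... | xy , xz∧yz with ∧-true⁻ xz∧yz
    ... | xz , yz = triangle G (xy , yz , xz)

    packing : Fin k → Triangle G
    packing s = proj₁ (cellTriangle (select-holds complete♭ s))

    packing-vertices : ∀ s {w} → w ∈T packing s → uncurry (λ i j → Among (x i) (y j) (apex i j)) (cellOf s) w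
    packing-vertices s = proj₂ (cellTriangle (select-holds complete♭ s))

    packing-disjoint : IsPacking G k packing
    packing-disjoint s t s≢t (u , w , u≢w , u∈s , w∈s , u∈t , w∈t)
      with two-coordinates-agree (transversal _ _) (transversal _ _) u≢w
             (packing-vertices s u∈s) (packing-vertices s w∈s) (packing-vertices t u∈t) (packing-vertices t w∈t)
    ... | K , L , K≢L , agreeK , agreeL = s≢t (cellOf-injective (same-cell K L K≢L agreeK agreeL))

    k≡∑∑complete : k ≡ ∑[ i < a ] ∑[ j < b ] 𝟙 (complete i j)
    k≡∑∑complete = begin
      k                                                  ≡⟨ ∑-combine a b (𝟙 ∘ complete♭) ⟨
      ∑[ i < a ] ∑[ j < b ] 𝟙 (complete♭ (combine i j))
        ≡⟨ sum-cong-≗ {a} (λ i → sum-cong-≗ {b} (λ j → cong (𝟙 ∘ uncurry complete) (Fin.remQuot-combine i j))) ⟩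
      ∑[ i < a ] ∑[ j < b ] 𝟙 (complete i j)             ∎
      where open ≡-Reasoning

    missed-by-x : ∑[ i < a ] ∑[ j < b ] 𝟙 (not (adj G (x i) (apex i j))) ≤ between nonAdj A C
    missed-by-x = begin
      ∑[ i < a ] ∑[ j < b ] 𝟙 (not (adj G (x i) (z (cell i j))))
        ≤⟨ ∑-mono-≤ (λ i → ∑-injective-≤ (cell i) (cell-injectiveʳ i) (λ l → 𝟙 (not (adj G (x i) (z l))))) ⟩
      ∑[ i < a ] ∑[ l < c ] 𝟙 (not (adj G (x i) (z l))) ≡⟨ between-select nonAdj A C ⟨
      between nonAdj A C                                ∎
      where open ≤-Reasoning

    missed-by-y : ∑[ i < a ] ∑[ j < b ] 𝟙 (not (adj G (y j) (apex i j))) ≤ between nonAdj B C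
    missed-by-y = begin
      ∑[ i < a ] ∑[ j < b ] 𝟙 (not (adj G (y j) (z (cell i j))))
        ≡⟨ ∑-comm (λ i j → 𝟙 (not (adj G (y j) (z (cell i j))))) ⟩
      ∑[ j < b ] ∑[ i < a ] 𝟙 (not (adj G (y j) (z (cell i j))))
        ≤⟨ ∑-mono-≤ (λ j → ∑-injective-≤ (λ i → cell i j) (cell-injectiveˡ j) (λ l → 𝟙 (not (adj G (y j) (z l))))) ⟩
      ∑[ j < b ] ∑[ l < c ] 𝟙 (not (adj G (y j) (z l))) ≡⟨ between-select nonAdj B C ⟨
      between nonAdj B C                                ∎
      where open ≤-Reasoning

    AB≤k+missing : between (adj G) A B ≤ k + between nonAdj A C + between nonAdj B C
    AB≤k+missing = begin
      between (adj G) A B                             ≡⟨ between-select (adj G) A B ⟩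
      ∑[ i < a ] ∑[ j < b ] 𝟙 (adj G (x i) (y j))     ≤⟨ ∑-mono-≤ (λ i → ∑-mono-≤ (λ j → complete-or-missing (adj G (x i) (y j)) _ _)) ⟩
      ∑[ i < a ] ∑[ j < b ] (𝟙 (complete i j) + missX i j + missY i j)
        ≡⟨ ∑∑-distrib-+ (λ i j → 𝟙 (complete i j) + missX i j) missY ⟩
      ∑[ i < a ] ∑[ j < b ] (𝟙 (complete i j) + missX i j) + ∑[ i < a ] ∑[ j < b ] missY i j
        ≡⟨ cong (_+ ∑[ i < a ] ∑[ j < b ] missY i j) (∑∑-distrib-+ (λ i j → 𝟙 (complete i j)) missX) ⟩
      ∑[ i < a ] ∑[ j < b ] 𝟙 (complete i j) + ∑[ i < a ] ∑[ j < b ] missX i j + ∑[ i < a ] ∑[ j < b ] missY i j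
        ≤⟨ +-mono-≤ (+-mono-≤ (≤-reflexive (sym k≡∑∑complete)) missed-by-x) missed-by-y ⟩
      k + between nonAdj A C + between nonAdj B C     ∎
      where
      open ≤-Reasoning
      missX missY : Fin a → Fin b → ℕ
      missX i j = 𝟙 (not (adj G (x i) (apex i j)))
      missY i j = 𝟙 (not (adj G (y j) (apex i j)))
      complete-or-missing : ∀ r s t → 𝟙 r ≤ 𝟙 (r ∧ (s ∧ t)) + 𝟙 (not s) + 𝟙 (not t)
      complete-or-missing false s     t     = z≤n
      complete-or-missing true  false t     = s≤s z≤n
      complete-or-missing true  true  false = s≤s z≤n
      complete-or-missing true  true  true  = s≤s z≤n

    edgeCount-≤-k : edgeCount G ≤ k + (a + b) * c
    edgeCount-≤-k = begin
      edgeCount G                                                   ≤⟨ edgeCount-≤ ⟩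
      between (adj G) A B + between (adj G) A C + between (adj G) B C
        ≤⟨ +-monoˡ-≤ _ (+-monoˡ-≤ _ AB≤k+missing) ⟩
      k + between nonAdj A C + between nonAdj B C + between (adj G) A C + between (adj G) B C
        ≡⟨ regroup k (between nonAdj A C) (between nonAdj B C) (between (adj G) A C) (between (adj G) B C) ⟩
      k + ((between (adj G) A C + between nonAdj A C) + (between (adj G) B C + between nonAdj B C))
        ≡⟨ cong₂ (λ p q → k + (p + q)) (between-complement (adj G) A C) (between-complement (adj G) B C) ⟩
      k + (a * c + b * c)                                           ≡⟨ cong (k +_) (*-distribʳ-+ c a b) ⟨
      k + (a + b) * c                                               ∎
      where
      open ≤-Reasoning
      regroup : ∀ k p q r s → k + p + q + r + s ≡ k + ((r + p) + (s + q))
      regroup = solve-∀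

    k≤AB : k ≤ between (adj G) A B
    k≤AB = begin
      k                                           ≡⟨ k≡∑∑complete ⟩
      ∑[ i < a ] ∑[ j < b ] 𝟙 (complete i j)          ≤⟨ ∑-mono-≤ (λ i → ∑-mono-≤ (λ j → 𝟙-∧-≤ (adj G (x i) (y j)) _)) ⟩
      ∑[ i < a ] ∑[ j < b ] 𝟙 (adj G (x i) (y j)) ≡⟨ between-select (adj G) A B ⟨
      between (adj G) A B                         ∎
      where
      open ≤-Reasoning
      𝟙-∧-≤ : ∀ r s → 𝟙 (r ∧ s) ≤ 𝟙 r
      𝟙-∧-≤ false s     = z≤n
      𝟙-∧-≤ true  false = z≤n
      𝟙-∧-≤ true  true  = ≤-refl

    k≤ν : ∀ {v} → IsNu G v → k ≤ v
    k≤ν (_ , maximal) = maximal k packing packing-disjoint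

argmax : ∀ {n} (f : Fin (suc n) → ℕ) → Σ (Fin (suc n)) λ K → ∀ L → f L ≤ f K
argmax {zero} f = zero , λ { zero → ≤-refl }
argmax {suc n} f with argmax (f ∘ suc)
... | K , max with f zero ≤? f (suc K)
...   | yes f₀≤ = suc K , λ { zero → f₀≤ ; (suc L) → max L }
...   | no  f₀≰ = zero , λ { zero → ≤-refl ; (suc L) → ≤-trans (max L) (<⇒≤ (≰⇒> f₀≰)) }

count-relabel : ∀ {n} (part : Fin n → Fin 3) (π : Permutation 3 3) K →
                count (inPart ((π ⟨$⟩ʳ_) ∘ part) K) ≡ count (inPart part (π ⟨$⟩ˡ K))
count-relabel {n} part π K = sum-cong-≗ {n} (λ u → cong 𝟙 (same u))
  where
  same : ∀ u → inPart ((π ⟨$⟩ʳ_) ∘ part) K u ≡ inPart part (π ⟨$⟩ˡ K) u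
  same u with π ⟨$⟩ʳ part u ≟ K | part u ≟ π ⟨$⟩ˡ K
  ... | yes _   | yes _  = refl
  ... | no _    | no _   = refl
  ... | yes πp≡K | no p≢ = ⊥-elim (p≢ (trans (sym (inverseˡ π)) (cong (π ⟨$⟩ˡ_) πp≡K)))
  ... | no πp≢K | yes p≡ = ⊥-elim (πp≢K (trans (cong (π ⟨$⟩ʳ_) p≡) (inverseʳ π)))

largest-part-last : ∀ {n} (G : Graph n) → Tripartite G →
  Σ (Tripartite G) λ (part , _) → count (inPart part 0F) ≤ count (inPart part 2F)
                                × count (inPart part 1F) ≤ count (inPart part 2F)
largest-part-last {n} G (part , proper) with argmax (count ∘ inPart part)
... | K , largest = (part′ , proper′) , ≤-largest 0F , ≤-largest 1F
  where
  π : Permutation 3 3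
  π = transpose 2F K
  part′ : Fin n → Fin 3
  part′ = (π ⟨$⟩ʳ_) ∘ part
  proper′ : ∀ u v → adj G u v ≡ true → part′ u ≢ part′ v
  proper′ u v uv eq = proper u v uv (trans (sym (inverseˡ π)) (trans (cong (π ⟨$⟩ˡ_) eq) (inverseˡ π)))
  π⁻¹2F≡K : ∀ K → transpose 2F K ⟨$⟩ˡ 2F ≡ K
  π⁻¹2F≡K 0F = refl
  π⁻¹2F≡K 1F = refl
  π⁻¹2F≡K 2F = refl
  ≤-largest : ∀ L → count (inPart part′ L) ≤ count (inPart part′ 2F)
  ≤-largest L = begin
    count (inPart part′ L)              ≡⟨ count-relabel part π L ⟩
    count (inPart part (π ⟨$⟩ˡ L))      ≤⟨ largest (π ⟨$⟩ˡ L) ⟩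
    count (inPart part K)               ≡⟨ cong (count ∘ inPart part) (π⁻¹2F≡K K) ⟨
    count (inPart part (π ⟨$⟩ˡ 2F))     ≡⟨ count-relabel part π 2F ⟨
    count (inPart part′ 2F)             ∎
    where open ≤-Reasoning

theorem2 : ∀ (n : ℕ) (G : Graph n) → Tripartite G →
    ∀ (t v : ℕ) → IsTau G t → IsNu G v →
    n * n < 4 * edgeCount G →
    3 * (4 * edgeCount G ∸ n * n) * t ≤ n * n * v
theorem2 n G tripartite t v τ ν n²<4m with largest-part-last G tripartite
... | (part , proper) , a≤c , b≤c = begin
  3 * (4 * edgeCount G ∸ n * n) * t                     ≤⟨ *-monoʳ-≤ (3 * (4 * edgeCount G ∸ n * n)) (τ≤AB τ) ⟩
  3 * (4 * edgeCount G ∸ n * n) * between (adj G) A B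
    ≤⟨ cover-vs-packing {a} {b} {c} a+b+c≡n edgeCount-≤-k k≤AB AB≤ab (<⇒≤ n²<4m) ⟩
  n * n * k                                             ≤⟨ *-monoʳ-≤ (n * n) (k≤ν ν) ⟩
  n * n * v                                             ∎
  where
  open ≤-Reasoning
  open Tripartition G part proper
  open LatinPacking a≤c b≤c
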